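{- Let $Z=(U,\Omega,\mathcal{C})$ be a tight $k$-matroid for some odd $k\geq 3$. Let $X\subseteq U$ and let $Y$ be a union of some skew classes of $\Omega$. Let $b_1$ be the number of bases of $Z$ that are bases of $Z[X]$ and $b_2$ the number of bases of $Z$ that are bases of $Z[X\,\Delta\,Y]$. Then $b_1$ and $b_2$ have the same parity.
   Context: A carrier is $(U,\Omega)$ with $\Omega$ a partition of finite $U$ into skew classes; a skew pair is a 2-subset of a skew class; transversals meet each class in exactly one element, subtransversals are subsets of transversals. A semi-multimatroid $Z=(U,\Omega,\mathcal{C})$ has circuits $\mathcal{C}$ (subtransversals) such that each $(T,\mathcal{C}\cap 2^T)$, $T$ a transversal, is a matroid (by circuits); for a subtransversal $S$ write $Z[S]$ for the matroid $(S,\mathcal C\cap 2^S)$. For general $X\subseteq U$, the restriction $Z[X]$ is the semi-multimatroid with ground set $X$, skew classes the nonempty sets $\omega\cap X$, and circuits $\mathcal{C}\cap 2^X$. Independent sets are subtransversals containing no circuit; bases are inclusion-maximal independent sets. A multimatroid is a semi-multimatroid where no union of two circuits contains exactly one skew pair; it is tight if for every subtransversal $S$ with $|S|=|\Omega|-1$ and $\omega$ the class disjoint from $S$, some $x\in\omega$ makes the circuit families of $Z[S\cup\{x\}]$ and $Z[S]$ differ. A $k$-matroid is a multimatroid all of whose skew classes have exactly $k$ elements. $\Delta$ denotes symmetric difference. -}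

module Defs where

open import Data.Nat using (ℕ; _∸_)
open import Data.Fin using (Fin; _≟_)
open import Data.Fin.Subset using (Subset; _∈_; _∉_; _⊆_; _∪_; _∩_; _─_; ⁅_⁆; ⊤; ⊥; ∣_∣)
open import Data.Vec using (tabulate)
open import Data.List using (List)
import Data.List.Membership.Propositional as LM
open import Data.Product using (Σ; ∃; ∃-syntax; _×_)
open import Data.Sum using (_⊎_)
open import Relation.Nullary using (¬_; does)
open import Relation.Binary.PropositionalEquality using (_≡_; _≢_)
open import Function.Bundles using (_⇔_)

-- A carrier (U, Ω) with U = Fin n, and Ω given by a class-index map
-- cls : Fin n → Fin m (the skew class of x is {y | cls y ≡ cls x}),
-- together with a finite family 𝒞 of subsets of U (the circuits).
record SMData : Set where
  field
    n   : ℕ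
    m   : ℕ
    cls : Fin n → Fin m
    𝒞   : List (Subset n)

module _ (Z : SMData) where
  open SMData Z

  _∈𝒞 : Subset n → Set
  C ∈𝒞 = C LM.∈ 𝒞

  skewClass : Fin m → Subset n
  skewClass j = tabulate (λ x → does (cls x ≟ j))

  _Δ_ : Subset n → Subset n → Subset n
  A Δ B = (A ─ B) ∪ (B ─ A)

  IsSubtransversal : Subset n → Set
  IsSubtransversal S = ∀ x y → x ∈ S → y ∈ S → cls x ≡ cls y → x ≡ y

  IsTransversal : Subset n → Set
  IsTransversal T = IsSubtransversal T × (∀ j → ∃[ x ] (x ∈ T × cls x ≡ j))

  IsMatroidOn : Subset n → Set
  IsMatroidOn T =
    (∀ C → C ∈𝒞 → C ⊆ T → C ≢ ⊥)
    × (∀ C₁ C₂ → C₁ ∈𝒞 → C₂ ∈𝒞 → C₁ ⊆ T → C₂ ⊆ T → C₁ ⊆ C₂ → C₁ ≡ C₂)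
    × (∀ C₁ C₂ e → C₁ ∈𝒞 → C₂ ∈𝒞 → C₁ ⊆ T → C₂ ⊆ T → C₁ ≢ C₂ → e ∈ C₁ → e ∈ C₂ →
         ∃[ C₃ ] (C₃ ∈𝒞 × C₃ ⊆ T × C₃ ⊆ ((C₁ ∪ C₂) ─ ⁅ e ⁆)))

  IsSemiMultimatroid : Set
  IsSemiMultimatroid =
    (∀ C → C ∈𝒞 → IsSubtransversal C)
    × (∀ T → IsTransversal T → IsMatroidOn T)

  ExactlyOneSkewPair : Subset n → Set
  ExactlyOneSkewPair A =
    ∃[ x ] ∃[ y ] (x ≢ y × x ∈ A × y ∈ A × cls x ≡ cls y ×
      (∀ x' y' → x' ≢ y' → x' ∈ A → y' ∈ A → cls x' ≡ cls y' →
         (x' ≡ x × y' ≡ y) ⊎ (x' ≡ y × y' ≡ x)))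

  IsMultimatroid : Set
  IsMultimatroid = IsSemiMultimatroid
    × (∀ C₁ C₂ → C₁ ∈𝒞 → C₂ ∈𝒞 → ¬ ExactlyOneSkewPair (C₁ ∪ C₂))

  CircuitOf : Subset n → Subset n → Set
  CircuitOf S C = C ∈𝒞 × C ⊆ S

  IsTight : Set
  IsTight = ∀ S → IsSubtransversal S → ∣ S ∣ ≡ m ∸ 1 →
    ∀ j → (∀ x → x ∈ S → x ∉ skewClass j) →
    ∃[ x ] (x ∈ skewClass j ×
      ¬ (∀ C → CircuitOf (S ∪ ⁅ x ⁆) C ⇔ CircuitOf S C))

  IsKMatroid : ℕ → Set
  IsKMatroid k = IsMultimatroid × (∀ j → ∣ skewClass j ∣ ≡ k)

  -- Restriction Z[X]: ground set X, skew classes ω ∩ X, circuits 𝒞 ∩ 2^X.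
  -- Independent sets of Z[X]: subtransversals of Z[X] (i.e. subtransversals
  -- contained in X) containing no circuit of Z[X].
  IsIndependentIn : Subset n → Subset n → Set
  IsIndependentIn X I = I ⊆ X × IsSubtransversal I × (∀ C → C ∈𝒞 → C ⊆ X → ¬ (C ⊆ I))

  IsBasisIn : Subset n → Subset n → Set
  IsBasisIn X B = IsIndependentIn X B × (∀ I → IsIndependentIn X I → B ⊆ I → I ≡ B)

  IsBasis : Subset n → Set
  IsBasis = IsBasisIn ⊤

  IsUnionOfSkewClasses : Subset n → Set
  IsUnionOfSkewClasses Y = ∀ x y → cls x ≡ cls y → x ∈ Y → y ∈ Y

-- A basis B of Z missing a skew class ω could be enlarged by one of two distinct elements of ω,
-- since the multimatroid axiom lets at most one element of ω make B dependent; so the bases of Z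
-- are its independent transversals. Flip the skew classes of Y one at a time. For one class ω, the
-- independent transversals inside X and inside X Δ ω together are the independent transversals T
-- with T ∖ ω ⊆ X. Grouped by S = T ∖ ω, the group of S is {S ∪ {x} : x ∈ ω, S ∪ {x} independent};
-- tightness makes at least one S ∪ {x} dependent and the multimatroid axiom at most one, so every
-- group has k − 1 elements, an even number.
module Submission where

open import Defs

module ListCounting where

  open import Data.Nat using (suc; _+_; _≤_; s≤s; parity)
  open import Data.Nat.Properties using (+-suc; ≤-refl; ≤-trans)
  open import Data.Parity.Base as ℙ using (0ℙ)
  open import Data.Parity.Properties using (+-homo-+)
  open import Data.List using (List; []; _∷_; length; filter; map)
  open import Data.List.Properties using (filter-accept; filter-reject; length-filter)
  open import Data.List.Membership.Propositional using (_∈_)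
  open import Data.List.Membership.Propositional.Properties using (∈-filter⁻)
  open import Data.List.Membership.Propositional.Properties.WithK using (unique∧set⇒bag)
  open import Data.List.Relation.Binary.BagAndSetEquality using (∼bag⇒↭)
  open import Data.List.Relation.Binary.Permutation.Propositional.Properties using (↭-length)
  import Data.List.Relation.Unary.All as All
  import Data.List.Relation.Unary.All.Properties as All
  open import Data.List.Relation.Unary.Any using (here; there)
  open import Data.List.Relation.Unary.Unique.Propositional using (Unique; []; _∷_)
  open import Data.Product using (_×_; _,_; proj₁; proj₂)
  open import Function.Bundles using (_⇔_; mk⇔; Equivalence)
  open import Level using (Level)
  open import Relation.Binary.Definitions using (DecidableEquality)
  open import Function using (_∘_)
  open import Relation.Binary.PropositionalEquality
    using (_≡_; _≢_; refl; sym; trans; cong; cong₂; subst; module ≡-Reasoning)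
  open import Relation.Nullary using (yes; no)
  open import Relation.Unary using (Pred; Decidable)
  open import Relation.Unary.Properties using (∁?)

  open ≡-Reasoning

  private
    variable
      a b p q r : Level
      A : Set a
      B : Set b

  length-filter+filter-∁ : {P : Pred A p} (P? : Decidable P) (xs : List A) →
                           length (filter P? xs) + length (filter (∁? P?) xs) ≡ length xs
  length-filter+filter-∁ P? [] = refl
  length-filter+filter-∁ P? (x ∷ xs) with P? x
  ... | yes _ = cong suc (length-filter+filter-∁ P? xs)
  ... | no _  = trans (+-suc _ _) (cong suc (length-filter+filter-∁ P? xs))

  filter-filter-≐ : {P : Pred A p} {Q : Pred A q} {R : Pred A r}
                    (P? : Decidable P) (Q? : Decidable Q) (R? : Decidable R) →
                    (∀ {x} → (Q x × P x) ⇔ R x) → ∀ xs → filter P? (filter Q? xs) ≡ filter R? xs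
  filter-filter-≐ P? Q? R? QP⇔R [] = refl
  filter-filter-≐ P? Q? R? QP⇔R (x ∷ xs) with ih ← filter-filter-≐ P? Q? R? QP⇔R xs | Q? x
  ... | no ¬Qx = trans ih (sym (filter-reject R? (¬Qx ∘ proj₁ ∘ Equivalence.from QP⇔R)))
  ... | yes Qx with P? x
  ...   | yes Px = trans (cong (x ∷_) ih) (sym (filter-accept R? (Equivalence.to QP⇔R (Qx , Px))))
  ...   | no ¬Px = trans ih (sym (filter-reject R? (¬Px ∘ proj₂ ∘ Equivalence.from QP⇔R)))

  length-≡-by-membership : {xs ys : List A} → Unique xs → Unique ys →
                           (∀ {z} → z ∈ xs ⇔ z ∈ ys) → length xs ≡ length ys
  length-≡-by-membership !xs !ys xs⇔ys = ↭-length (∼bag⇒↭ (unique∧set⇒bag !xs !ys xs⇔ys))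

  map⁺-injectiveOn : (f : A → B) {xs : List A} →
                     (∀ {x y} → x ∈ xs → y ∈ xs → f x ≡ f y → x ≡ y) →
                     Unique xs → Unique (map f xs)
  map⁺-injectiveOn f {[]} _ [] = []
  map⁺-injectiveOn f {x ∷ xs} inj (x∉xs ∷ !xs) =
    All.map⁺ (All.tabulate (λ y∈xs fx≡fy → All.lookup x∉xs y∈xs (inj (here refl) (there y∈xs) fx≡fy)))
    ∷ map⁺-injectiveOn f (λ x∈ y∈ → inj (there x∈) (there y∈)) !xs

  module _ (_≟_ : DecidableEquality B) (f : A → B) where

    fibre : A → List A → List A
    fibre x = filter (λ y → f y ≟ f x)

    even-fibres⇒even-length : (xs : List A) →
                              (∀ {x} → x ∈ xs → parity (length (fibre x xs)) ≡ 0ℙ) →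
                              parity (length xs) ≡ 0ℙ
    even-fibres⇒even-length xs = bounded (length xs) xs ≤-refl
      where
      bounded : ∀ n xs → length xs ≤ n →
                (∀ {x} → x ∈ xs → parity (length (fibre x xs)) ≡ 0ℙ) → parity (length xs) ≡ 0ℙ
      bounded _ [] _ _ = refl
      bounded (suc n) (x ∷ xs) (s≤s |xs|≤n) even = begin
        parity (length (x ∷ xs))
          ≡⟨ cong parity (sym (length-filter+filter-∁ (λ y → f y ≟ f x) (x ∷ xs))) ⟩
        parity (length (fibre x (x ∷ xs)) + length rest)
          ≡⟨ +-homo-+ (length (fibre x (x ∷ xs))) (length rest) ⟩
        parity (length (fibre x (x ∷ xs))) ℙ.+ parity (length rest)
          ≡⟨ cong₂ ℙ._+_ (even (here refl)) (bounded n rest |rest|≤n evenRest) ⟩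
        0ℙ ∎
        where
        offFibre? = ∁? (λ y → f y ≟ f x)
        rest = filter offFibre? (x ∷ xs)
        |rest|≤n : length rest ≤ n
        |rest|≤n = subst (λ ys → length ys ≤ n) (sym (filter-reject offFibre? (λ ¬fx≡fx → ¬fx≡fx refl)))
                         (≤-trans (length-filter offFibre? xs) |xs|≤n)
        evenRest : ∀ {y} → y ∈ rest → parity (length (fibre y rest)) ≡ 0ℙ
        evenRest {y} y∈rest with ∈-filter⁻ offFibre? {xs = x ∷ xs} y∈rest
        ... | y∈x∷xs , fy≢fx = trans
          (cong (parity ∘ length)
                (filter-filter-≐ (λ z → f z ≟ f y) offFibre? (λ z → f z ≟ f y) fibre⊆rest (x ∷ xs)))
          (even y∈x∷xs)
          where
          fibre⊆rest : ∀ {z} → (f z ≢ f x × f z ≡ f y) ⇔ f z ≡ f y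
          fibre⊆rest = mk⇔ proj₂ (λ fz≡fy → (λ fz≡fx → fy≢fx (trans (sym fz≡fy) fz≡fx)) , fz≡fy)

module ParityMod2 where

  open import Data.Nat using (zero; suc; _%_; parity)
  open import Data.Parity.Base using (1ℙ)
  open import Relation.Binary.PropositionalEquality using (_≡_; refl)

  parity≡⇒%2≡ : ∀ a b → parity a ≡ parity b → a % 2 ≡ b % 2
  parity≡⇒%2≡ (suc (suc a)) b              eq = parity≡⇒%2≡ a b eq
  parity≡⇒%2≡ zero          (suc (suc b)) eq = parity≡⇒%2≡ zero b eq
  parity≡⇒%2≡ (suc zero)    (suc (suc b)) eq = parity≡⇒%2≡ 1 b eq
  parity≡⇒%2≡ zero          zero          _  = refl
  parity≡⇒%2≡ (suc zero)    (suc zero)    _  = refl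
  parity≡⇒%2≡ zero          (suc zero)    ()
  parity≡⇒%2≡ (suc zero)    zero          ()

  %2≡1⇒parity≡1ℙ : ∀ a → a % 2 ≡ 1 → parity a ≡ 1ℙ
  %2≡1⇒parity≡1ℙ (suc zero)    _  = refl
  %2≡1⇒parity≡1ℙ (suc (suc a)) eq = %2≡1⇒parity≡1ℙ a eq
  %2≡1⇒parity≡1ℙ zero          ()

module Subsets where

  open import Data.Bool using () renaming (_≟_ to _≟ᵇ_)
  open import Data.Nat using (ℕ; zero; suc; _≤_; s≤s)
  open import Data.Fin using (Fin) renaming (zero to fzero; suc to fsuc)
  open import Data.Fin.Subset using (Subset; _∈_; _∉_; _∪_; _∩_; _─_; ⁅_⁆; ⊥; ∣_∣; inside; outside)
  open import Data.Fin.Subset.Properties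
    using (_∈?_; x∈p∪q⁺; x∈p∪q⁻; x∈⁅y⁆⇒x≡y; p─q⊆p; x∈p∧x∉q⇒x∈p─q)
  open import Data.List using (List; []; _∷_; length; filter; map; allFin; tabulate; cartesianProductWith)
  open import Data.List.Properties using (length-map; map-tabulate)
  open import Data.List.Membership.Propositional using () renaming (_∈_ to _∈ˡ_)
  open import Data.List.Membership.Propositional.Properties
    using (∈-filter⁺; ∈-filter⁻; ∈-allFin; ∈-cartesianProductWith⁺)
  open import Data.List.Relation.Unary.All using ([]; _∷_)
  open import Data.List.Relation.Unary.Any using (here; there)
  open import Data.List.Relation.Unary.Unique.Propositional using (Unique; []; _∷_)
  open import Data.List.Relation.Unary.Unique.Propositional.Properties
    using (filter⁺; allFin⁺; cartesianProductWith⁺)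
  open import Data.Vec using ([]; _∷_; here; there)
  open import Data.Vec.Properties using (∷-injective; ≡-dec)
  open import Data.Product using (∃-syntax; _×_; _,_; proj₂)
  open import Data.Sum using (_⊎_; inj₁; inj₂)
  open import Function using (_∘_)
  open import Function.Bundles using (_⇔_; mk⇔)
  open import Relation.Binary.PropositionalEquality using (_≡_; _≢_; refl; sym; trans; cong; subst)
  open import Relation.Binary.Definitions using (DecidableEquality)
  open import Relation.Nullary using (yes; no; contradiction)

  private
    variable
      n : ℕ

  infix 4 _≟ₛ_
  _≟ₛ_ : DecidableEquality (Subset n)
  _≟ₛ_ = ≡-dec _≟ᵇ_

  subsets : ∀ n → List (Subset n)
  subsets zero    = [] ∷ []
  subsets (suc n) = cartesianProductWith _∷_ (inside ∷ outside ∷ []) (subsets n)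

  ∈-subsets : (p : Subset n) → p ∈ˡ subsets n
  ∈-subsets []            = here refl
  ∈-subsets (inside ∷ p)  =
    ∈-cartesianProductWith⁺ _∷_ {xs = inside ∷ outside ∷ []} (here refl) (∈-subsets p)
  ∈-subsets (outside ∷ p) =
    ∈-cartesianProductWith⁺ _∷_ {xs = inside ∷ outside ∷ []} (there (here refl)) (∈-subsets p)

  subsets-unique : ∀ n → Unique (subsets n)
  subsets-unique zero    = [] ∷ []
  subsets-unique (suc n) = cartesianProductWith⁺ {xs = inside ∷ outside ∷ []} {ys = subsets n}
    _∷_ ∷-injective (((λ ()) ∷ []) ∷ [] ∷ []) (subsets-unique n)

  members : Subset n → List (Fin n)
  members {n} p = filter (_∈? p) (allFin n)

  ∈-members⁺ : ∀ {x} {p : Subset n} → x ∈ p → x ∈ˡ members p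
  ∈-members⁺ {x = x} {p} = ∈-filter⁺ (_∈? p) (∈-allFin x)

  ∈-members⁻ : ∀ {x} {p : Subset n} → x ∈ˡ members p → x ∈ p
  ∈-members⁻ {n} {p = p} = proj₂ ∘ ∈-filter⁻ (_∈? p) {xs = allFin n}

  members-unique : (p : Subset n) → Unique (members p)
  members-unique {n} p = filter⁺ (_∈? p) (allFin⁺ n)

  private
    filter-∈?-∷-map-suc : ∀ s (p : Subset n) xs →
                          filter (_∈? (s ∷ p)) (map fsuc xs) ≡ map fsuc (filter (_∈? p) xs)
    filter-∈?-∷-map-suc s p [] = refl
    filter-∈?-∷-map-suc s p (x ∷ xs) with x ∈? p
    ... | yes _ = cong (fsuc x ∷_) (filter-∈?-∷-map-suc s p xs)
    ... | no _  = filter-∈?-∷-map-suc s p xs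

    length-members-∷ : ∀ s (p : Subset n) →
                       length (filter (_∈? (s ∷ p)) (tabulate fsuc)) ≡ length (members p)
    length-members-∷ {n} s p = trans
      (cong (length ∘ filter (_∈? (s ∷ p))) (sym (map-tabulate (λ x → x) fsuc)))
      (trans (cong length (filter-∈?-∷-map-suc s p (allFin n))) (length-map fsuc (members p)))

  length-members : (p : Subset n) → length (members p) ≡ ∣ p ∣
  length-members []            = refl
  length-members (inside ∷ p)  = cong suc (trans (length-members-∷ inside p) (length-members p))
  length-members (outside ∷ p) = trans (length-members-∷ outside p) (length-members p)

  two-members : (p : Subset n) → 2 ≤ ∣ p ∣ → ∃[ x ] ∃[ y ] (x ≢ y × x ∈ p × y ∈ p)
  two-members p 2≤∣p∣ = pick (members p) (members-unique p)
    (subst (2 ≤_) (sym (length-members p)) 2≤∣p∣) ∈-members⁻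
    where
    pick : ∀ xs → Unique xs → 2 ≤ length xs → (∀ {x} → x ∈ˡ xs → x ∈ p) →
           ∃[ x ] ∃[ y ] (x ≢ y × x ∈ p × y ∈ p)
    pick (x ∷ y ∷ _) ((x≢y ∷ _) ∷ _) _ ∈p = x , y , x≢y , ∈p (here refl) , ∈p (there (here refl))
    pick (_ ∷ []) _ (s≤s ()) _

  x∈p─q⇒x∉q : ∀ {x} (p q : Subset n) → x ∈ p ─ q → x ∉ q
  x∈p─q⇒x∉q (_ ∷ p) (_ ∷ q)      (there x∈p─q) (there x∈q) = x∈p─q⇒x∉q p q x∈p─q x∈q
  x∈p─q⇒x∉q (_ ∷ _) (inside ∷ _) ()            here

  x∈p∪⁅y⁆⁻ : ∀ {x} (p : Subset n) y → x ∈ p ∪ ⁅ y ⁆ → x ∈ p ⊎ x ≡ y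
  x∈p∪⁅y⁆⁻ p y x∈ with x∈p∪q⁻ p ⁅ y ⁆ x∈
  ... | inj₁ x∈p = inj₁ x∈p
  ... | inj₂ x∈⁅y⁆ = inj₂ (x∈⁅y⁆⇒x≡y y x∈⁅y⁆)

  -- Symmetric difference at every length; at length SMData.n Z it is definitionally _Δ_ Z.
  infixl 5 _⊖_
  _⊖_ : Subset n → Subset n → Subset n
  p ⊖ q = (p ─ q) ∪ (q ─ p)

  x∉q⇒x∈p⊖q⇔x∈p : ∀ {x} {p q : Subset n} → x ∉ q → x ∈ p ⊖ q ⇔ x ∈ p
  x∉q⇒x∈p⊖q⇔x∈p {x = x} {p} {q} x∉q =
    mk⇔ to (λ x∈p → x∈p∪q⁺ (inj₁ (x∈p∧x∉q⇒x∈p─q x∈p x∉q)))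
    where
    to : x ∈ p ⊖ q → x ∈ p
    to x∈p⊖q with x∈p∪q⁻ (p ─ q) (q ─ p) x∈p⊖q
    ... | inj₁ x∈p─q = p─q⊆p p q x∈p─q
    ... | inj₂ x∈q─p = contradiction (p─q⊆p q p x∈q─p) x∉q

  x∈q⇒x∈p⊖q⇔x∉p : ∀ {x} {p q : Subset n} → x ∈ q → x ∈ p ⊖ q ⇔ x ∉ p
  x∈q⇒x∈p⊖q⇔x∉p {x = x} {p} {q} x∈q =
    mk⇔ to (λ x∉p → x∈p∪q⁺ (inj₂ (x∈p∧x∉q⇒x∈p─q x∈q x∉p)))
    where
    to : x ∈ p ⊖ q → x ∉ p
    to x∈p⊖q with x∈p∪q⁻ (p ─ q) (q ─ p) x∈p⊖q
    ... | inj₁ x∈p─q = contradiction x∈q (x∈p─q⇒x∉q p q x∈p─q)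
    ... | inj₂ x∈q─p = x∈p─q⇒x∉q q p x∈q─p

  ⊖-identityʳ : (p : Subset n) → p ⊖ ⊥ ≡ p
  ⊖-identityʳ []            = refl
  ⊖-identityʳ (inside ∷ p)  = cong (inside ∷_) (⊖-identityʳ p)
  ⊖-identityʳ (outside ∷ p) = cong (outside ∷_) (⊖-identityʳ p)

  ⊖-split : (p q r : Subset n) → p ⊖ q ≡ p ⊖ (q ∩ r) ⊖ (q ─ r)
  ⊖-split []      []      []      = refl
  ⊖-split (inside  ∷ p) (inside  ∷ q) (inside  ∷ r) = cong (_ ∷_) (⊖-split p q r)
  ⊖-split (inside  ∷ p) (inside  ∷ q) (outside ∷ r) = cong (_ ∷_) (⊖-split p q r)
  ⊖-split (inside  ∷ p) (outside ∷ q) (inside  ∷ r) = cong (_ ∷_) (⊖-split p q r)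
  ⊖-split (inside  ∷ p) (outside ∷ q) (outside ∷ r) = cong (_ ∷_) (⊖-split p q r)
  ⊖-split (outside ∷ p) (inside  ∷ q) (inside  ∷ r) = cong (_ ∷_) (⊖-split p q r)
  ⊖-split (outside ∷ p) (inside  ∷ q) (outside ∷ r) = cong (_ ∷_) (⊖-split p q r)
  ⊖-split (outside ∷ p) (outside ∷ q) (inside  ∷ r) = cong (_ ∷_) (⊖-split p q r)
  ⊖-split (outside ∷ p) (outside ∷ q) (outside ∷ r) = cong (_ ∷_) (⊖-split p q r)

module Multimatroids (Z : SMData) where

  open SMData Z
  open ListCounting
  open Subsets

  open import Data.Nat using (_+_; _∸_; _≤_; parity)
  open import Data.Fin using (Fin; _≟_)
  open import Data.Fin.Properties using (any?; all?)
  open import Data.Fin.Subset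
    using (Subset; _∈_; _∉_; _⊆_; _∪_; _∩_; _─_; ⁅_⁆; ⊥; ∁; ∣_∣)
  open import Data.Fin.Subset.Properties
    using (_∈?_; _⊆?_; ⊆-antisym; ⊆-trans; ⊆⊤; x∈p∪q⁺; x∈p∪q⁻; p⊆p∪q; q⊆p∪q; x∈p∩q⁺; x∈p∩q⁻;
           p∩q⊆q; p─q⊆p; x∈p∧x∉q⇒x∈p─q; x∈⁅x⁆; x∉⁅y⁆⇒x≢y; x≢y⇒x∉⁅y⁆; x∉p⇒x∈∁p; x∈∁p⇒x∉p;
           nonempty?; Empty-unique; ∣∁p∣≡n∸∣p∣; ∣⁅x⁆∣≡1)
  open import Data.Vec.Properties using (lookup∘tabulate; []=⇒lookup; lookup⇒[]=)
  open import Data.List using (List; []; _∷_; length; filter; map; allFin)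
  open import Data.List.Properties using (length-map)
  open import Data.List.Membership.Propositional using (find; lose) renaming (_∈_ to _∈ˡ_)
  open import Data.List.Membership.Propositional.Properties
    using (∈-filter⁺; ∈-filter⁻; ∈-map⁺; ∈-map⁻; ∈-allFin)
  open import Data.List.Relation.Unary.All using ([]; _∷_)
  open import Data.List.Relation.Unary.Any as Any using (here; there)
  open import Data.List.Relation.Unary.Unique.Propositional using (Unique; []; _∷_)
  open import Data.List.Relation.Unary.Unique.Propositional.Properties using (filter⁺)
  open import Data.Parity.Base as ℙ using (Parity; 0ℙ; 1ℙ)
  open import Data.Parity.Properties using (+-homo-+; +-cancelˡ-≡; p+p≡0ℙ)
  open import Data.Product using (∃-syntax; _×_; _,_; proj₁; proj₂)
  open import Data.Sum using (_⊎_; inj₁; inj₂; map₂)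
  open import Function using (_∘_)
  open import Function.Bundles using (_⇔_; mk⇔; Equivalence)
  open import Relation.Binary.PropositionalEquality
    using (_≡_; _≢_; refl; sym; trans; cong; cong₂; subst; module ≡-Reasoning)
  open import Relation.Nullary using (¬_; yes; no; contradiction)
  open import Relation.Nullary.Decidable using (_×-dec_; _→-dec_; map′; dec-true)
  open import Relation.Unary using (Decidable)
  open import Relation.Unary.Properties using (∁?)

  Dependent : Subset n → Set
  Dependent A = ∃[ C ] (C ∈ˡ 𝒞 × C ⊆ A)

  Independent : Subset n → Set
  Independent A = ¬ Dependent A

  dependent? : Decidable Dependent
  dependent? A = map′ find (λ (_ , C∈𝒞 , C⊆A) → lose C∈𝒞 C⊆A) (Any.any? (_⊆? A) 𝒞)

  subtransversal? : Decidable (IsSubtransversal Z)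
  subtransversal? S = all? λ x → all? λ y →
    (x ∈? S) →-dec (y ∈? S) →-dec (cls x ≟ cls y) →-dec (x ≟ y)

  transversal? : Decidable (IsTransversal Z)
  transversal? T = subtransversal? T ×-dec all? (λ j → any? (λ x → (x ∈? T) ×-dec (cls x ≟ j)))

  ∈-skewClass⁺ : ∀ {x j} → cls x ≡ j → x ∈ skewClass Z j
  ∈-skewClass⁺ {x} {j} clsx≡j =
    lookup⇒[]= x _ (trans (lookup∘tabulate _ x) (dec-true (cls x ≟ j) clsx≡j))

  ∈-skewClass⁻ : ∀ {x j} → x ∈ skewClass Z j → cls x ≡ j
  ∈-skewClass⁻ {x} {j} x∈ with cls x ≟ j | trans (sym (lookup∘tabulate _ x)) ([]=⇒lookup x∈)
  ... | yes clsx≡j | _  = clsx≡j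
  ... | no _       | ()

  Misses : Subset n → Fin m → Set
  Misses S j = ∀ {y} → y ∈ S → cls y ≢ j

  subtransversal-∪⁅⁆ : ∀ {S x} → IsSubtransversal Z S → Misses S (cls x) →
                       IsSubtransversal Z (S ∪ ⁅ x ⁆)
  subtransversal-∪⁅⁆ {S} {x} sub misses y z y∈ z∈ same with x∈p∪⁅y⁆⁻ S x y∈ | x∈p∪⁅y⁆⁻ S x z∈
  ... | inj₁ y∈S  | inj₁ z∈S  = sub y z y∈S z∈S same
  ... | inj₁ y∈S  | inj₂ refl = contradiction same (misses y∈S)
  ... | inj₂ refl | inj₁ z∈S  = contradiction (sym same) (misses z∈S)
  ... | inj₂ refl | inj₂ refl = refl

  circuit⊆S∪⁅x⁆⇒x∈circuit : ∀ {S x C} → Independent S → C ∈ˡ 𝒞 → C ⊆ S ∪ ⁅ x ⁆ → x ∈ C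
  circuit⊆S∪⁅x⁆⇒x∈circuit {S} {x} {C} indS C∈𝒞 C⊆S∪⁅x⁆ with x ∈? C
  ... | yes x∈C = x∈C
  ... | no x∉C  = contradiction (C , C∈𝒞 , λ {y} → C⊆S {y}) indS
    where
    C⊆S : C ⊆ S
    C⊆S {y} y∈C with x∈p∪⁅y⁆⁻ S x (C⊆S∪⁅x⁆ y∈C)
    ... | inj₁ y∈S  = y∈S
    ... | inj₂ refl = contradiction y∈C x∉C

  -- Two distinct dependent extensions would give circuits whose union has {x, y} as its only skew pair.
  dependentExtension-unique : IsMultimatroid Z → ∀ {S j x y} →
    IsSubtransversal Z S → Independent S → Misses S j → cls x ≡ j → cls y ≡ j →
    Dependent (S ∪ ⁅ x ⁆) → Dependent (S ∪ ⁅ y ⁆) → x ≡ y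
  dependentExtension-unique (_ , noSingleSkewPair) {S} {j} {x} {y} sub indS misses clsx≡j clsy≡j
    (C₁ , C₁∈𝒞 , C₁⊆) (C₂ , C₂∈𝒞 , C₂⊆) with x ≟ y
  ... | yes x≡y = x≡y
  ... | no x≢y  = contradiction onlySkewPair (noSingleSkewPair C₁ C₂ C₁∈𝒞 C₂∈𝒞)
    where
    locate : ∀ {w} → w ∈ C₁ ∪ C₂ → w ∈ S ⊎ (w ≡ x ⊎ w ≡ y)
    locate w∈ with x∈p∪q⁻ C₁ C₂ w∈
    ... | inj₁ w∈C₁ = map₂ inj₁ (x∈p∪⁅y⁆⁻ S x (C₁⊆ w∈C₁))
    ... | inj₂ w∈C₂ = map₂ inj₂ (x∈p∪⁅y⁆⁻ S y (C₂⊆ w∈C₂))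

    inClass : ∀ {w} → w ≡ x ⊎ w ≡ y → cls w ≡ j
    inClass (inj₁ refl) = clsx≡j
    inClass (inj₂ refl) = clsy≡j

    onlyPair : ∀ w w' → w ≢ w' → w ∈ C₁ ∪ C₂ → w' ∈ C₁ ∪ C₂ → cls w ≡ cls w' →
               (w ≡ x × w' ≡ y) ⊎ (w ≡ y × w' ≡ x)
    onlyPair w w' w≢w' w∈ w'∈ same with locate w∈ | locate w'∈
    ... | inj₁ w∈S  | inj₁ w'∈S  = contradiction (sub w w' w∈S w'∈S same) w≢w'
    ... | inj₁ w∈S  | inj₂ w'∈xy = contradiction (trans same (inClass w'∈xy)) (misses w∈S)
    ... | inj₂ w∈xy | inj₁ w'∈S  = contradiction (trans (sym same) (inClass w∈xy)) (misses w'∈S)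
    ... | inj₂ (inj₁ refl) | inj₂ (inj₂ refl) = inj₁ (refl , refl)
    ... | inj₂ (inj₂ refl) | inj₂ (inj₁ refl) = inj₂ (refl , refl)
    ... | inj₂ (inj₁ refl) | inj₂ (inj₁ refl) = contradiction refl w≢w'
    ... | inj₂ (inj₂ refl) | inj₂ (inj₂ refl) = contradiction refl w≢w'

    onlySkewPair : ExactlyOneSkewPair Z (C₁ ∪ C₂)
    onlySkewPair = x , y , x≢y
      , x∈p∪q⁺ (inj₁ (circuit⊆S∪⁅x⁆⇒x∈circuit indS C₁∈𝒞 C₁⊆))
      , x∈p∪q⁺ (inj₂ (circuit⊆S∪⁅x⁆⇒x∈circuit indS C₂∈𝒞 C₂⊆))
      , trans clsx≡j (sym clsy≡j) , onlyPair

  IsIndependentTransversalIn : Subset n → Subset n → Set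
  IsIndependentTransversalIn X T = IsTransversal Z T × Independent T × T ⊆ X

  independentTransversalIn? : ∀ X → Decidable (IsIndependentTransversalIn X)
  independentTransversalIn? X T = transversal? T ×-dec ∁? dependent? T ×-dec T ⊆? X

  independentTransversalsIn : Subset n → List (Subset n)
  independentTransversalsIn X = filter (independentTransversalIn? X) (subsets n)

  transversal-maximal : ∀ {T S} → IsTransversal Z T → IsSubtransversal Z S → T ⊆ S → S ≡ T
  transversal-maximal {T} {S} (_ , covers) subS T⊆S = ⊆-antisym S⊆T T⊆S
    where
    S⊆T : ∀ {x} → x ∈ S → x ∈ T
    S⊆T {x} x∈S with covers (cls x)
    ... | y , y∈T , clsy≡clsx = subst (_∈ T) (subS y x (T⊆S y∈T) x∈S clsy≡clsx) y∈T

  independentIn⇒independent : ∀ {X I} → IsIndependentIn Z X I → Independent I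
  independentIn⇒independent (I⊆X , _ , noCircuit) (C , C∈𝒞 , C⊆I) =
    noCircuit C C∈𝒞 (⊆-trans C⊆I I⊆X) C⊆I

  independent⇒independentIn : ∀ {X I} → I ⊆ X → IsSubtransversal Z I → Independent I →
                              IsIndependentIn Z X I
  independent⇒independentIn I⊆X subI indI = I⊆X , subI , λ C C∈𝒞 _ C⊆I → indI (C , C∈𝒞 , C⊆I)

  ∣transversal─skewClass∣ : ∀ {T} j → IsTransversal Z T → ∣ T ─ skewClass Z j ∣ ≡ m ∸ 1
  ∣transversal─skewClass∣ {T} j (subT , covers) = begin
    ∣ T ─ ω ∣                                ≡⟨ sym (length-members (T ─ ω)) ⟩
    length (members (T ─ ω))                 ≡⟨ sym (length-map cls (members (T ─ ω))) ⟩
    length (map cls (members (T ─ ω)))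
      ≡⟨ length-≡-by-membership classes-unique (members-unique (∁ ⁅ j ⁆)) (mk⇔ to from) ⟩
    length (members (∁ ⁅ j ⁆))               ≡⟨ length-members (∁ ⁅ j ⁆) ⟩
    ∣ ∁ ⁅ j ⁆ ∣                              ≡⟨ ∣∁p∣≡n∸∣p∣ ⁅ j ⁆ ⟩
    m ∸ ∣ ⁅ j ⁆ ∣                            ≡⟨ cong (m ∸_) (∣⁅x⁆∣≡1 j) ⟩
    m ∸ 1                                    ∎
    where
    open ≡-Reasoning
    ω = skewClass Z j

    inT : ∀ {x} → x ∈ˡ members (T ─ ω) → x ∈ T
    inT = p─q⊆p T ω ∘ ∈-members⁻

    classes-unique : Unique (map cls (members (T ─ ω)))
    classes-unique =
      map⁺-injectiveOn cls (λ x∈ y∈ → subT _ _ (inT x∈) (inT y∈)) (members-unique (T ─ ω))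

    to : ∀ {i} → i ∈ˡ map cls (members (T ─ ω)) → i ∈ˡ members (∁ ⁅ j ⁆)
    to i∈ with ∈-map⁻ cls i∈
    ... | x , x∈ , refl = ∈-members⁺ (x∉p⇒x∈∁p (x≢y⇒x∉⁅y⁆ (x∉ω ∘ ∈-skewClass⁺)))
      where
      x∉ω : x ∉ ω
      x∉ω = x∈p─q⇒x∉q T ω (∈-members⁻ x∈)

    from : ∀ {i} → i ∈ˡ members (∁ ⁅ j ⁆) → i ∈ˡ map cls (members (T ─ ω))
    from {i} i∈ with covers i
    ... | x , x∈T , refl = ∈-map⁺ cls (∈-members⁺ (x∈p∧x∉q⇒x∈p─q x∈T x∉ω))
      where
      x∉ω : x ∉ ω
      x∉ω x∈ω = x∉⁅y⁆⇒x≢y (x∈∁p⇒x∉p (∈-members⁻ i∈)) (∈-skewClass⁻ x∈ω)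

  subtransversal-⊆ : ∀ {S T} → S ⊆ T → IsSubtransversal Z T → IsSubtransversal Z S
  subtransversal-⊆ S⊆T subT x y x∈S y∈S = subT x y (S⊆T x∈S) (S⊆T y∈S)

  independent-⊆ : ∀ {A B} → A ⊆ B → Independent B → Independent A
  independent-⊆ A⊆B indB (C , C∈𝒞 , C⊆A) = indB (C , C∈𝒞 , A⊆B ∘ C⊆A)

  ─skewClass-misses : ∀ T j → Misses (T ─ skewClass Z j) j
  ─skewClass-misses T j y∈ clsy≡j =
    x∈p─q⇒x∉q T (skewClass Z j) y∈ (∈-skewClass⁺ clsy≡j)

  subtransversal≡─skewClass∪⁅⁆ : ∀ {T x j} → IsSubtransversal Z T → x ∈ T → x ∈ skewClass Z j →
                              T ≡ (T ─ skewClass Z j) ∪ ⁅ x ⁆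
  subtransversal≡─skewClass∪⁅⁆ {T} {x} {j} subT x∈T x∈ω = ⊆-antisym ⊆-∪ ∪-⊆
    where
    ω = skewClass Z j
    ⊆-∪ : T ⊆ (T ─ ω) ∪ ⁅ x ⁆
    ⊆-∪ {z} z∈T with z ∈? ω
    ... | no z∉ω  = x∈p∪q⁺ (inj₁ (x∈p∧x∉q⇒x∈p─q z∈T z∉ω))
    ... | yes z∈ω = subst (_∈ (T ─ ω) ∪ ⁅ x ⁆)
      (subT x z x∈T z∈T (trans (∈-skewClass⁻ x∈ω) (sym (∈-skewClass⁻ z∈ω))))
      (x∈p∪q⁺ (inj₂ (x∈⁅x⁆ x)))
    ∪-⊆ : (T ─ ω) ∪ ⁅ x ⁆ ⊆ T
    ∪-⊆ z∈ with x∈p∪⁅y⁆⁻ (T ─ ω) x z∈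
    ... | inj₁ z∈T─ω = p─q⊆p T ω z∈T─ω
    ... | inj₂ refl  = x∈T

  ∪⁅⁆─skewClass≡ : ∀ {S x j} → Misses S j → x ∈ skewClass Z j → (S ∪ ⁅ x ⁆) ─ skewClass Z j ≡ S
  ∪⁅⁆─skewClass≡ {S} {x} {j} misses x∈ω = ⊆-antisym ─-⊆ ⊆-─
    where
    ω = skewClass Z j
    ─-⊆ : (S ∪ ⁅ x ⁆) ─ ω ⊆ S
    ─-⊆ z∈ with x∈p∪⁅y⁆⁻ S x (p─q⊆p (S ∪ ⁅ x ⁆) ω z∈)
    ... | inj₁ z∈S = z∈S
    ... | inj₂ refl = contradiction x∈ω (x∈p─q⇒x∉q (S ∪ ⁅ x ⁆) ω z∈)
    ⊆-─ : S ⊆ (S ∪ ⁅ x ⁆) ─ ω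
    ⊆-─ z∈S = x∈p∧x∉q⇒x∈p─q (p⊆p∪q ⁅ x ⁆ z∈S) (misses z∈S ∘ ∈-skewClass⁻)

  transversal-─skewClass-∪⁅⁆ : ∀ {T x j} → IsTransversal Z T → x ∈ skewClass Z j →
                               IsTransversal Z ((T ─ skewClass Z j) ∪ ⁅ x ⁆)
  transversal-─skewClass-∪⁅⁆ {T} {x} {j} (subT , covers) x∈ω = sub , covers′
    where
    ω = skewClass Z j
    clsx≡j = ∈-skewClass⁻ x∈ω
    sub : IsSubtransversal Z ((T ─ ω) ∪ ⁅ x ⁆)
    sub = subtransversal-∪⁅⁆ (subtransversal-⊆ (p─q⊆p T ω) subT)
      (subst (Misses (T ─ ω)) (sym clsx≡j) (─skewClass-misses T j))
    covers′ : ∀ i → ∃[ y ] (y ∈ (T ─ ω) ∪ ⁅ x ⁆ × cls y ≡ i)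
    covers′ i with i ≟ j | covers i
    ... | yes refl | _ = x , x∈p∪q⁺ (inj₂ (x∈⁅x⁆ x)) , clsx≡j
    ... | no i≢j | y , y∈T , refl =
      y , x∈p∪q⁺ (inj₁ (x∈p∧x∉q⇒x∈p─q y∈T (i≢j ∘ ∈-skewClass⁻))) , refl

  ⊆⊖skewClass⇔ : ∀ {T X} j → IsTransversal Z T →
                 T ⊆ X ⊖ skewClass Z j ⇔ (T ⊆ X ∪ skewClass Z j × ¬ T ⊆ X)
  ⊆⊖skewClass⇔ {T} {X} j (subT , covers) = mk⇔ to from
    where
    ω = skewClass Z j

    ∈X∪ω⇒∈X : ∀ {w} → w ∈ X ∪ ω → w ∉ ω → w ∈ X
    ∈X∪ω⇒∈X w∈ w∉ω with x∈p∪q⁻ X ω w∈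
    ... | inj₁ w∈X = w∈X
    ... | inj₂ w∈ω = contradiction w∈ω w∉ω

    sameClass : ∀ {w z} → w ∈ T → z ∈ T → w ∈ ω → z ∈ ω → w ≡ z
    sameClass w∈T z∈T w∈ω z∈ω = subT _ _ w∈T z∈T
      (trans (∈-skewClass⁻ w∈ω) (sym (∈-skewClass⁻ z∈ω)))

    to : T ⊆ X ⊖ ω → T ⊆ X ∪ ω × ¬ T ⊆ X
    to T⊆X⊖ω = T⊆X∪ω , T⊈X
      where
      T⊆X∪ω : T ⊆ X ∪ ω
      T⊆X∪ω {z} z∈T with z ∈? ω
      ... | yes z∈ω = q⊆p∪q X ω z∈ω
      ... | no z∉ω  = p⊆p∪q ω (Equivalence.to (x∉q⇒x∈p⊖q⇔x∈p z∉ω) (T⊆X⊖ω z∈T))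
      T⊈X : ¬ T ⊆ X
      T⊈X T⊆X with covers j
      ... | x , x∈T , clsx≡j = Equivalence.to (x∈q⇒x∈p⊖q⇔x∉p x∈ω) (T⊆X⊖ω x∈T) (T⊆X x∈T)
        where x∈ω = ∈-skewClass⁺ clsx≡j

    from : T ⊆ X ∪ ω × ¬ T ⊆ X → T ⊆ X ⊖ ω
    from (T⊆X∪ω , T⊈X) {z} z∈T with z ∈? ω
    ... | no z∉ω  = Equivalence.from (x∉q⇒x∈p⊖q⇔x∈p z∉ω) (∈X∪ω⇒∈X (T⊆X∪ω z∈T) z∉ω)
    ... | yes z∈ω = Equivalence.from (x∈q⇒x∈p⊖q⇔x∉p z∈ω) (T⊈X ∘ T⊆X)
      where
      T⊆X : z ∈ X → T ⊆ X
      T⊆X z∈X {w} w∈T with w ∈? ω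
      ... | yes w∈ω = subst (_∈ X) (sameClass z∈T w∈T z∈ω w∈ω) z∈X
      ... | no w∉ω  = ∈X∪ω⇒∈X (T⊆X∪ω w∈T) w∉ω

  module _ (mm : IsMultimatroid Z) (classes≥2 : ∀ j → 2 ≤ ∣ skewClass Z j ∣) where

    basis⇒transversal : ∀ {B} → IsBasis Z B → IsTransversal Z B
    basis⇒transversal {B} (indepB@(_ , subB , _) , maximal) = subB , covers
      where
      cannotExtend : ∀ {x} → Misses B (cls x) → ¬ Independent (B ∪ ⁅ x ⁆)
      cannotExtend {x} misses indB∪x = misses (subst (x ∈_) B∪x≡B (x∈p∪q⁺ (inj₂ (x∈⁅x⁆ x)))) refl
        where
        B∪x≡B : B ∪ ⁅ x ⁆ ≡ B
        B∪x≡B = maximal (B ∪ ⁅ x ⁆)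
          (independent⇒independentIn ⊆⊤ (subtransversal-∪⁅⁆ subB misses) indB∪x)
          (p⊆p∪q ⁅ x ⁆)

      covers : ∀ j → ∃[ x ] (x ∈ B × cls x ≡ j)
      covers j with any? (λ x → (x ∈? B) ×-dec (cls x ≟ j))
      ... | yes found = found
      ... | no none = contradiction (two-members (skewClass Z j) (classes≥2 j)) noTwoMembers
        where
        misses : Misses B j
        misses y∈B clsy≡j = none (_ , y∈B , clsy≡j)

        missesClassOf : ∀ {x} → x ∈ skewClass Z j → Misses B (cls x)
        missesClassOf x∈ω rewrite ∈-skewClass⁻ x∈ω = misses

        noTwoMembers : ¬ (∃[ a ] ∃[ b ] (a ≢ b × a ∈ skewClass Z j × b ∈ skewClass Z j))
        noTwoMembers (a , b , a≢b , a∈ω , b∈ω) with dependent? (B ∪ ⁅ a ⁆) | dependent? (B ∪ ⁅ b ⁆)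
        ... | no indB∪a | _ = cannotExtend (missesClassOf a∈ω) indB∪a
        ... | yes _ | no indB∪b = cannotExtend (missesClassOf b∈ω) indB∪b
        ... | yes depB∪a | yes depB∪b = a≢b (dependentExtension-unique mm subB
          (independentIn⇒independent indepB) misses (∈-skewClass⁻ a∈ω) (∈-skewClass⁻ b∈ω) depB∪a depB∪b)

    basis⇔independentTransversal : ∀ {X B} →
                                   (IsBasis Z B × IsBasisIn Z X B) ⇔ IsIndependentTransversalIn X B
    basis⇔independentTransversal {X} {B} = mk⇔ to from
      where
      to : IsBasis Z B × IsBasisIn Z X B → IsIndependentTransversalIn X B
      to (basisB , (indepB@(B⊆X , _) , _)) =
        basis⇒transversal basisB , independentIn⇒independent indepB , B⊆X

      from : IsIndependentTransversalIn X B → IsBasis Z B × IsBasisIn Z X B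
      from (transB@(subB , _) , indB , B⊆X) =
        (independent⇒independentIn ⊆⊤ subB indB , maximal) ,
        (independent⇒independentIn B⊆X subB indB , maximal)
        where
        maximal : ∀ {Y} I → IsIndependentIn Z Y I → B ⊆ I → I ≡ B
        maximal I (_ , subI , _) = transversal-maximal transB subI

    length-bases : ∀ {X l} → Unique l → (∀ B → B ∈ˡ l ⇔ (IsBasis Z B × IsBasisIn Z X B)) →
                   length l ≡ length (independentTransversalsIn X)
    length-bases {X} {l} !l l⇔bases = length-≡-by-membership !l
      (filter⁺ (independentTransversalIn? X) (subsets-unique n)) (mk⇔ to from)
      where
      to : ∀ {B} → B ∈ˡ l → B ∈ˡ independentTransversalsIn X
      to {B} B∈l = ∈-filter⁺ (independentTransversalIn? X) (∈-subsets B)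
        (Equivalence.to basis⇔independentTransversal (Equivalence.to (l⇔bases B) B∈l))
      from : ∀ {B} → B ∈ˡ independentTransversalsIn X → B ∈ˡ l
      from {B} B∈ = Equivalence.from (l⇔bases B) (Equivalence.from basis⇔independentTransversal
        (proj₂ (∈-filter⁻ (independentTransversalIn? X) {xs = subsets n} B∈)))

  tight⇒dependentExtension : IsTight Z → ∀ {S j} → IsSubtransversal Z S → Independent S →
    ∣ S ∣ ≡ m ∸ 1 → Misses S j → ∃[ x ] (x ∈ skewClass Z j × Dependent (S ∪ ⁅ x ⁆))
  tight⇒dependentExtension tight {S} {j} subS indS ∣S∣≡m-1 misses
    with tight S subS ∣S∣≡m-1 j (λ _ x∈S x∈ω → misses x∈S (∈-skewClass⁻ x∈ω))
  ... | x , x∈ω , circuitsDiffer with dependent? (S ∪ ⁅ x ⁆)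
  ...   | yes depS∪x = x , x∈ω , depS∪x
  ...   | no indS∪x  = contradiction (λ C → mk⇔ (noCircuit indS∪x) (noCircuit indS)) circuitsDiffer
    where
    noCircuit : ∀ {A B C} → Independent A → CircuitOf Z A C → CircuitOf Z B C
    noCircuit {C = C} indA (C∈𝒞 , C⊆A) = contradiction (C , C∈𝒞 , λ {y} → C⊆A {y}) indA

  dependentExtension? : (S : Subset n) → Decidable (λ x → Dependent (S ∪ ⁅ x ⁆))
  dependentExtension? S x = dependent? (S ∪ ⁅ x ⁆)

  dependentExtensions independentExtensions : Subset n → Fin m → List (Fin n)
  dependentExtensions   S j = filter (dependentExtension? S) (members (skewClass Z j))
  independentExtensions S j = filter (∁? (dependentExtension? S)) (members (skewClass Z j))

  module _ (mm : IsMultimatroid Z) (tight : IsTight Z) {S : Subset n} {j : Fin m}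
           (subS : IsSubtransversal Z S) (indS : Independent S) (∣S∣≡m-1 : ∣ S ∣ ≡ m ∸ 1)
           (misses : Misses S j) where

    private
      ω = skewClass Z j

    length-dependentExtensions : length (dependentExtensions S j) ≡ 1
    length-dependentExtensions with tight⇒dependentExtension tight subS indS ∣S∣≡m-1 misses
    ... | x₀ , x₀∈ω , depS∪x₀ = length-≡-by-membership
      (filter⁺ (dependentExtension? S) (members-unique ω)) ([] ∷ []) (mk⇔ to from)
      where
      to : ∀ {x} → x ∈ˡ dependentExtensions S j → x ∈ˡ x₀ ∷ []
      to x∈ with ∈-filter⁻ (dependentExtension? S) {xs = members ω} x∈
      ... | x∈members , depS∪x = here (dependentExtension-unique mm subS indS misses
        (∈-skewClass⁻ (∈-members⁻ x∈members)) (∈-skewClass⁻ x₀∈ω) depS∪x depS∪x₀)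
      from : ∀ {x} → x ∈ˡ x₀ ∷ [] → x ∈ˡ dependentExtensions S j
      from (here refl) = ∈-filter⁺ (dependentExtension? S) (∈-members⁺ x₀∈ω) depS∪x₀

    even-independentExtensions : parity ∣ ω ∣ ≡ 1ℙ → parity (length (independentExtensions S j)) ≡ 0ℙ
    even-independentExtensions odd = +-cancelˡ-≡ 1ℙ _ _ (begin
      1ℙ ℙ.+ parity (length (independentExtensions S j))
        ≡⟨ sym (+-homo-+ 1 (length (independentExtensions S j))) ⟩
      parity (1 + length (independentExtensions S j))
        ≡⟨ cong (λ d → parity (d + length (independentExtensions S j))) (sym length-dependentExtensions) ⟩
      parity (length (dependentExtensions S j) + length (independentExtensions S j))
        ≡⟨ cong parity (length-filter+filter-∁ (dependentExtension? S) (members ω)) ⟩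
      parity (length (members ω))  ≡⟨ cong parity (length-members ω) ⟩
      parity ∣ ω ∣                 ≡⟨ odd ⟩
      1ℙ                           ∎)
      where open ≡-Reasoning

  module _ (mm : IsMultimatroid Z) (tight : IsTight Z) (j : Fin m)
           (odd : parity ∣ skewClass Z j ∣ ≡ 1ℙ) (X : Subset n) where

    private
      ω = skewClass Z j
      candidates = independentTransversalsIn (X ∪ ω)

      candidates-unique : Unique candidates
      candidates-unique = filter⁺ (independentTransversalIn? (X ∪ ω)) (subsets-unique n)

      length-candidates : length (independentTransversalsIn X) + length (independentTransversalsIn (X ⊖ ω))
                          ≡ length candidates
      length-candidates = begin
        length (independentTransversalsIn X) + length (independentTransversalsIn (X ⊖ ω))
          ≡⟨ sym (cong₂ _+_ (cong length (filter-filter-≐ (_⊆? X) candidate? (inside? X) inX (subsets n)))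
                            (cong length (filter-filter-≐ (∁? (_⊆? X)) candidate? (inside? (X ⊖ ω))
                                                          notInX (subsets n)))) ⟩
        length (filter (_⊆? X) candidates) + length (filter (∁? (_⊆? X)) candidates)
          ≡⟨ length-filter+filter-∁ (_⊆? X) candidates ⟩
        length candidates ∎
        where
        open ≡-Reasoning
        inside? = independentTransversalIn?
        candidate? = inside? (X ∪ ω)

        inX : ∀ {T} → (IsIndependentTransversalIn (X ∪ ω) T × T ⊆ X) ⇔ IsIndependentTransversalIn X T
        inX = mk⇔ (λ ((transT , indT , _) , T⊆X) → transT , indT , T⊆X)
                  (λ (transT , indT , T⊆X) → (transT , indT , p⊆p∪q ω ∘ T⊆X) , T⊆X)

        notInX : ∀ {T} → (IsIndependentTransversalIn (X ∪ ω) T × ¬ T ⊆ X) ⇔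
                         IsIndependentTransversalIn (X ⊖ ω) T
        notInX = mk⇔
          (λ ((transT , indT , T⊆X∪ω) , T⊈X) →
             transT , indT , Equivalence.from (⊆⊖skewClass⇔ j transT) (T⊆X∪ω , T⊈X))
          (λ (transT , indT , T⊆X⊖ω) →
             let (T⊆X∪ω , T⊈X) = Equivalence.to (⊆⊖skewClass⇔ j transT) T⊆X⊖ω
             in (transT , indT , T⊆X∪ω) , T⊈X)

      length-fibre : ∀ {T} → IsIndependentTransversalIn (X ∪ ω) T →
                     length (fibre _≟ₛ_ (_─ ω) T candidates) ≡ length (independentExtensions (T ─ ω) j)
      length-fibre {T} (transT , indT , T⊆X∪ω) = begin
        length (fibre _≟ₛ_ (_─ ω) T candidates)
          ≡⟨ length-≡-by-membership (filter⁺ sameRest? candidates-unique)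
               (map⁺-injectiveOn extend injective (filter⁺ independent? (members-unique ω))) (mk⇔ to from) ⟩
        length (map extend (independentExtensions S j))
          ≡⟨ length-map extend (independentExtensions S j) ⟩
        length (independentExtensions S j) ∎
        where
        open ≡-Reasoning
        S = T ─ ω
        misses = ─skewClass-misses T j
        sameRest? = λ T′ → T′ ─ ω ≟ₛ S
        independent? = ∁? (dependentExtension? S)

        extend : Fin n → Subset n
        extend x = S ∪ ⁅ x ⁆

        ∈ω : ∀ {x} → x ∈ˡ independentExtensions S j → x ∈ ω
        ∈ω = ∈-members⁻ ∘ proj₁ ∘ ∈-filter⁻ independent? {xs = members ω}

        injective : ∀ {x y} → x ∈ˡ independentExtensions S j → y ∈ˡ independentExtensions S j →
                    extend x ≡ extend y → x ≡ y
        injective {x} {y} x∈ _ eq with x∈p∪⁅y⁆⁻ S y (subst (x ∈_) eq (x∈p∪q⁺ (inj₂ (x∈⁅x⁆ x))))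
        ... | inj₁ x∈S = contradiction (∈-skewClass⁻ (∈ω x∈)) (misses x∈S)
        ... | inj₂ x≡y = x≡y

        to : ∀ {T′} → T′ ∈ˡ fibre _≟ₛ_ (_─ ω) T candidates → T′ ∈ˡ map extend (independentExtensions S j)
        to {T′} T′∈ with ∈-filter⁻ sameRest? {xs = candidates} T′∈
        ... | T′∈cands , T′─ω≡S
            with proj₂ (∈-filter⁻ (independentTransversalIn? (X ∪ ω)) {xs = subsets n} T′∈cands)
        ...   | (subT′ , covers′) , indT′ , _ with covers′ j
        ...     | x , x∈T′ , clsx≡j = subst (_∈ˡ map extend (independentExtensions S j)) (sym T′≡S∪x)
          (∈-map⁺ extend (∈-filter⁺ independent? (∈-members⁺ x∈ω)
                                    (subst Independent T′≡S∪x indT′)))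
          where
          x∈ω = ∈-skewClass⁺ clsx≡j
          T′≡S∪x : T′ ≡ extend x
          T′≡S∪x = trans (subtransversal≡─skewClass∪⁅⁆ subT′ x∈T′ x∈ω) (cong (_∪ ⁅ x ⁆) T′─ω≡S)

        from : ∀ {T′} → T′ ∈ˡ map extend (independentExtensions S j) →
                        T′ ∈ˡ fibre _≟ₛ_ (_─ ω) T candidates
        from T′∈ with ∈-map⁻ extend T′∈
        ... | x , x∈ , refl = ∈-filter⁺ sameRest?
          (∈-filter⁺ (independentTransversalIn? (X ∪ ω)) (∈-subsets (extend x))
            (transversal-─skewClass-∪⁅⁆ transT (∈ω x∈) , proj₂ (∈-filter⁻ independent? {xs = members ω} x∈)
            , ⊆X∪ω))
          (∪⁅⁆─skewClass≡ misses (∈ω x∈))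
          where
          ⊆X∪ω : extend x ⊆ X ∪ ω
          ⊆X∪ω z∈ with x∈p∪⁅y⁆⁻ S x z∈
          ... | inj₁ z∈S  = T⊆X∪ω (p─q⊆p T ω z∈S)
          ... | inj₂ refl = q⊆p∪q X ω (∈ω x∈)

      even-candidates : parity (length candidates) ≡ 0ℙ
      even-candidates = even-fibres⇒even-length _≟ₛ_ (_─ ω) candidates evenFibre
        where
        evenFibre : ∀ {T} → T ∈ˡ candidates → parity (length (fibre _≟ₛ_ (_─ ω) T candidates)) ≡ 0ℙ
        evenFibre {T} T∈ with proj₂ (∈-filter⁻ (independentTransversalIn? (X ∪ ω)) {xs = subsets n} T∈)
        ... | candT@(transT , indT , _) = trans (cong parity (length-fibre candT))
          (even-independentExtensions mm tight
            (subtransversal-⊆ (p─q⊆p T ω) (proj₁ transT)) (independent-⊆ (p─q⊆p T ω) indT)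
            (∣transversal─skewClass∣ j transT) (─skewClass-misses T j) odd)

    parity-independentTransversalsIn-⊖skewClass :
      parity (length (independentTransversalsIn (X ⊖ ω))) ≡ parity (length (independentTransversalsIn X))
    parity-independentTransversalsIn-⊖skewClass = +-cancelˡ-≡ (parity a) _ _ (begin
      parity a ℙ.+ parity b       ≡⟨ sym (+-homo-+ a b) ⟩
      parity (a + b)              ≡⟨ cong parity length-candidates ⟩
      parity (length candidates)  ≡⟨ even-candidates ⟩
      0ℙ                          ≡⟨ sym (p+p≡0ℙ (parity a)) ⟩
      parity a ℙ.+ parity a       ∎)
      where
      open ≡-Reasoning
      a = length (independentTransversalsIn X)
      b = length (independentTransversalsIn (X ⊖ ω))

  unionOfSkewClasses-∩-skewClass : ∀ {Y} j → IsUnionOfSkewClasses Z Y →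
                                   Y ∩ skewClass Z j ≡ skewClass Z j ⊎ Y ∩ skewClass Z j ≡ ⊥
  unionOfSkewClasses-∩-skewClass {Y} j unionY with nonempty? (Y ∩ skewClass Z j)
  ... | no empty = inj₂ (Empty-unique empty)
  ... | yes (y , y∈) = inj₁ (⊆-antisym (p∩q⊆q Y ω) ω⊆Y∩ω)
    where
    ω = skewClass Z j
    ω⊆Y∩ω : ω ⊆ Y ∩ ω
    ω⊆Y∩ω {z} z∈ω with x∈p∩q⁻ Y ω y∈
    ... | y∈Y , y∈ω = x∈p∩q⁺ (unionY y z (trans (∈-skewClass⁻ y∈ω)
                                                  (sym (∈-skewClass⁻ z∈ω))) y∈Y , z∈ω)

  unionOfSkewClasses-─skewClass : ∀ {Y} j → IsUnionOfSkewClasses Z Y →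
                                  IsUnionOfSkewClasses Z (Y ─ skewClass Z j)
  unionOfSkewClasses-─skewClass {Y} j unionY x y same x∈ =
    x∈p∧x∉q⇒x∈p─q (unionY x y same (p─q⊆p Y ω x∈)) y∉ω
    where
    ω = skewClass Z j
    y∉ω : y ∉ ω
    y∉ω y∈ω = x∈p─q⇒x∉q Y ω x∈ (∈-skewClass⁺
      (trans same (∈-skewClass⁻ y∈ω)))

  module _ (mm : IsMultimatroid Z) (tight : IsTight Z)
           (odd : ∀ j → parity ∣ skewClass Z j ∣ ≡ 1ℙ) where

    parity-independentTransversalsIn-⊖ : ∀ X Y → IsUnionOfSkewClasses Z Y →
      parity (length (independentTransversalsIn (X ⊖ Y))) ≡ parity (length (independentTransversalsIn X))
    parity-independentTransversalsIn-⊖ X Y unionY =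
      flipAll (allFin m) X Y unionY (λ {y} _ → ∈-allFin (cls y))
      where
      #_ : Subset n → Parity
      # A = parity (length (independentTransversalsIn A))

      flipAll : ∀ J X Y → IsUnionOfSkewClasses Z Y → (∀ {y} → y ∈ Y → cls y ∈ˡ J) → # (X ⊖ Y) ≡ # X
      flipAll [] X Y _ inJ = begin
        # (X ⊖ Y) ≡⟨ cong (λ Y → # (X ⊖ Y)) (Empty-unique λ (_ , y∈Y) → contradiction (inJ y∈Y) λ ()) ⟩
        # (X ⊖ ⊥) ≡⟨ cong #_ (⊖-identityʳ X) ⟩
        # X       ∎
        where open ≡-Reasoning
      flipAll (j ∷ J) X Y unionY inJ = begin
        # (X ⊖ Y)                      ≡⟨ cong #_ (⊖-split X Y ω) ⟩
        # (X ⊖ (Y ∩ ω) ⊖ (Y ─ ω))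
          ≡⟨ flipAll J (X ⊖ (Y ∩ ω)) (Y ─ ω) (unionOfSkewClasses-─skewClass j unionY) inJ′ ⟩
        # (X ⊖ (Y ∩ ω))                ≡⟨ flipClass (unionOfSkewClasses-∩-skewClass j unionY) ⟩
        # X                            ∎
        where
        open ≡-Reasoning
        ω = skewClass Z j
        inJ′ : ∀ {y} → y ∈ Y ─ ω → cls y ∈ˡ J
        inJ′ {y} y∈ with inJ (p─q⊆p Y ω y∈)
        ... | here clsy≡j = contradiction (∈-skewClass⁺ clsy≡j) (x∈p─q⇒x∉q Y ω y∈)
        ... | there clsy∈J = clsy∈J
        flipClass : Y ∩ ω ≡ ω ⊎ Y ∩ ω ≡ ⊥ → # (X ⊖ (Y ∩ ω)) ≡ # X
        flipClass (inj₁ Y∩ω≡ω) rewrite Y∩ω≡ω =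
          parity-independentTransversalsIn-⊖skewClass mm tight j (odd j) X
        flipClass (inj₂ Y∩ω≡⊥) rewrite Y∩ω≡⊥ = cong #_ (⊖-identityʳ X)

open import Data.Nat using (ℕ; _≤_; _%_; parity)
open import Data.Nat.Properties using (≤-trans; n≤1+n)
open import Data.Fin.Subset using (Subset; ∣_∣)
open import Data.Parity.Base using (1ℙ)
open import Data.List using (List; length)
open import Data.List.Relation.Unary.Unique.Propositional using (Unique)
open import Data.List.Membership.Propositional using (_∈_)
open import Data.Product using (_×_; _,_)
open import Relation.Binary.PropositionalEquality using (_≡_; sym; trans; cong; subst; module ≡-Reasoning)
open import Function.Bundles using (_⇔_)
open ParityMod2
open Subsets using (_⊖_)

mainTheorem13 : (Z : SMData) (k : ℕ) → 3 ≤ k → k % 2 ≡ 1 →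
    IsKMatroid Z k → IsTight Z →
    (X Y : Subset (SMData.n Z)) → IsUnionOfSkewClasses Z Y →
    (l₁ l₂ : List (Subset (SMData.n Z))) →
    Unique l₁ → (∀ B → B ∈ l₁ ⇔ (IsBasis Z B × IsBasisIn Z X B)) →
    Unique l₂ → (∀ B → B ∈ l₂ ⇔ (IsBasis Z B × IsBasisIn Z (_Δ_ Z X Y) B)) →
    length l₁ % 2 ≡ length l₂ % 2
mainTheorem13 Z k 3≤k k-odd (mm , ∣skewClass∣≡k) tight X Y unionY l₁ l₂ !l₁ l₁⇔bases !l₂ l₂⇔bases =
  parity≡⇒%2≡ (length l₁) (length l₂) (begin
    parity (length l₁)                         ≡⟨ cong parity (length-bases mm classes≥2 !l₁ l₁⇔bases) ⟩
    parity (length (independentTransversalsIn X))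
      ≡⟨ sym (parity-independentTransversalsIn-⊖ mm tight odd X Y unionY) ⟩
    parity (length (independentTransversalsIn (X ⊖ Y)))
      ≡⟨ cong parity (sym (length-bases mm classes≥2 !l₂ l₂⇔bases)) ⟩
    parity (length l₂)                         ∎)
  where
  open ≡-Reasoning
  open Multimatroids Z

  classes≥2 : ∀ j → 2 ≤ ∣ skewClass Z j ∣
  classes≥2 j = subst (2 ≤_) (sym (∣skewClass∣≡k j)) (≤-trans (n≤1+n 2) 3≤k)

  odd : ∀ j → parity ∣ skewClass Z j ∣ ≡ 1ℙ
  odd j = trans (cong parity (∣skewClass∣≡k j)) (%2≡1⇒parity≡1ℙ k k-odd)
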